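{- For $n\geq0$ let $D_n$ denote the $1\times n$ misère Domineering rectangle, i.e., $D_0=D_1=0$ and, for $n\geq2$, $D_n=\{\cdot\mid D_a+D_b : a,b\geq0,\ a+b=n-2\}$. Then for every $n\geq0$, writing $n=6k+r$ with $0\leq r\leq5$, $D_n\equiv_{\mathcal{M}}V$, where $V$ is: $k\cdot(\bar{1}0)_\#$ if $r\in\{0,1\}$; $k\cdot(\bar{1}0)_\#+\bar{1}$ if $r\in\{2,3\}$; $k\cdot(\bar{1}0)_\#+\bar{1}0$ if $r=4$; $k\cdot(\bar{1}0)_\#+\bar{2}$ if $r=5$.
   Context: Games are finite partizan games $\{\mathscr{G}^L\mid\mathscr{G}^R\}$, with $\cdot$ denoting an empty set of options; $0=\{\cdot\mid\cdot\}$. Disjunctive sum $G+H=\{G^L+H,G+H^L\mid G^R+H,G+H^R\}$; $k\cdot G$ is the sum of $k$ copies of $G$ ($0\cdot G=0$). Notation: $\bar{1}=\{\cdot\mid0\}$, $\bar{2}=\{\cdot\mid\bar{1}\}$, $\bar{1}0=\{\cdot\mid\bar{1},0\}$, $(\bar{1}0)_\#=\{\cdot\mid\bar{1}0\}$. Misère outcomes: $o^L(G)=\mathscr{L}$ iff $G$ has no Left option or some $o^R(G^L)=\mathscr{L}$ (else $\mathscr{R}$); $o^R(G)=\mathscr{R}$ iff $G$ has no Right option or some $o^L(G^R)=\mathscr{R}$ (else $\mathscr{L}$); $o(G)=\mathscr{L},\mathscr{N},\mathscr{P},\mathscr{R}$ for $(o^L,o^R)=(\mathscr{L},\mathscr{L}),(\mathscr{L},\mathscr{R}),(\mathscr{R},\mathscr{L}),(\mathscr{R},\mathscr{R})$.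 $G\equiv_{\mathcal{M}}H$ means $o(G+X)=o(H+X)$ for every game $X$. (In $1\times n$ Domineering Left, who places vertical dominoes, has no move, and Right places a horizontal domino on two adjacent empty squares, splitting the strip.) -}

module Defs where

open import Data.Nat using (ℕ; zero; suc; _∸_)
open import Data.List using (List; []; _∷_; _++_; map; upTo)
open import Relation.Binary.PropositionalEquality using (_≡_)

data Game : Set where
  ⟨_∣_⟩ : List Game → List Game → Game

0G : Game
0G = ⟨ [] ∣ [] ⟩

mutual
  _⊕_ : Game → Game → Game
  ⟨ GL ∣ GR ⟩ ⊕ ⟨ HL ∣ HR ⟩ =
    ⟨ addˡ GL ⟨ HL ∣ HR ⟩ ++ addʳ ⟨ GL ∣ GR ⟩ HL
    ∣ addˡ GR ⟨ HL ∣ HR ⟩ ++ addʳ ⟨ GL ∣ GR ⟩ HR ⟩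

  addˡ : List Game → Game → List Game
  addˡ [] H = []
  addˡ (g ∷ gs) H = (g ⊕ H) ∷ addˡ gs H

  addʳ : Game → List Game → List Game
  addʳ G [] = []
  addʳ G (h ∷ hs) = (G ⊕ h) ∷ addʳ G hs

infixl 6 _⊕_

_·_ : ℕ → Game → Game
zero · G = 0G
suc k · G = G ⊕ (k · G)

data Player : Set where
  𝓛 𝓡 : Player

data Outcome : Set where
  𝓛o 𝓝o 𝓟o 𝓡o : Outcome

mutual
  oᴸ : Game → Player
  oᴸ ⟨ [] ∣ _ ⟩ = 𝓛
  oᴸ ⟨ g ∷ gs ∣ _ ⟩ = someRis𝓛 (g ∷ gs)

  oᴿ : Game → Player
  oᴿ ⟨ _ ∣ [] ⟩ = 𝓡
  oᴿ ⟨ _ ∣ g ∷ gs ⟩ = someLis𝓡 (g ∷ gs)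

  someRis𝓛 : List Game → Player
  someRis𝓛 [] = 𝓡
  someRis𝓛 (g ∷ gs) with oᴿ g
  ... | 𝓛 = 𝓛
  ... | 𝓡 = someRis𝓛 gs

  someLis𝓡 : List Game → Player
  someLis𝓡 [] = 𝓛
  someLis𝓡 (g ∷ gs) with oᴸ g
  ... | 𝓡 = 𝓡
  ... | 𝓛 = someLis𝓡 gs

outcomeOf : Player → Player → Outcome
outcomeOf 𝓛 𝓛 = 𝓛o
outcomeOf 𝓛 𝓡 = 𝓝o
outcomeOf 𝓡 𝓛 = 𝓟o
outcomeOf 𝓡 𝓡 = 𝓡o

o : Game → Outcome
o G = outcomeOf (oᴸ G) (oᴿ G)

_≡ₘ_ : Game → Game → Set
G ≡ₘ H = ∀ X → o (G ⊕ X) ≡ o (H ⊕ X)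

-- 1 × n misère Domineering.  Dfuel f n is D_n whenever f ≥ n
-- (fuel only ensures structural recursion).
-- D_0 = D_1 = 0, D_n = { · | D_a + D_b : a + b = n - 2 } for n ≥ 2.
Dfuel : ℕ → ℕ → Game
Dfuel zero _ = 0G
Dfuel (suc f) zero = 0G
Dfuel (suc f) (suc zero) = 0G
Dfuel (suc f) (suc (suc m)) =
  ⟨ [] ∣ map (λ a → Dfuel f a ⊕ Dfuel f (m ∸ a)) (upTo (suc m)) ⟩

D : ℕ → Game
D n = Dfuel n n

bar1 : Game
bar1 = ⟨ [] ∣ 0G ∷ [] ⟩

bar2 : Game
bar2 = ⟨ [] ∣ bar1 ∷ [] ⟩

bar10 : Game
bar10 = ⟨ [] ∣ bar1 ∷ 0G ∷ [] ⟩

bar10# : Game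
bar10# = ⟨ [] ∣ bar10 ∷ [] ⟩

-- The value V for n = 6k + r (r ≤ 5; the last clause is never used)
V : ℕ → ℕ → Game
V k 0 = k · bar10#
V k 1 = k · bar10#
V k 2 = k · bar10# ⊕ bar1
V k 3 = k · bar10# ⊕ bar1
V k 4 = k · bar10# ⊕ bar10
V k 5 = k · bar10# ⊕ bar2
V k _ = 0G

-- The games D n and V k r are Left-free: Left never has a move.  Between such
-- games, the simulation G ≼ H (every Right move in H is met by a Right move in G
-- that is again ≼, and G is Right-terminal whenever H is) makes G + X at least as
-- good for Right as H + X, for every X; so G ≼ H and H ≼ G give G ≡ₘ H.
--
-- With value n = V k r for n = 6k + r, D n ≈ value n follows by strong induction:
-- each move D a + D b of D n is met by a Right option g of value n with
-- g ≼ value a + value b, and each Right option h of value n by such a move with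
-- value a + value b ≼ h.  As value (6K + N) ≈ K·(1̄0)_# + value N, both matching
-- properties reduce to residues below 6, i.e. to finitely many instances of a
-- decidable condition, which are checked by evaluation.

module Submission where

open import Defs
open import Data.Bool using (Bool; true; false; T; _∧_; _∨_)
open import Data.Bool.ListAction using (all; any)
open import Data.Bool.Properties using (T-∧; T-∨)
open import Data.Empty using (⊥-elim)
open import Data.List using (List; []; _∷_; _++_; map; upTo; null)
open import Data.List.Membership.Propositional using (_∈_; find)
open import Data.List.Membership.Propositional.Properties
  using (∈-++⁺ˡ; ∈-++⁺ʳ; ∈-++⁻; ∈-map⁺; ∈-map⁻; ∈-upTo⁺; ∈-upTo⁻)
open import Data.List.Properties using (map-cong-local)
open import Data.List.Relation.Unary.All as All using ()
open import Data.List.Relation.Unary.All.Properties using (all⁺)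
open import Data.List.Relation.Unary.Any using (here; there)
open import Data.List.Relation.Unary.Any.Properties using (any⁻)
open import Data.Nat using (ℕ; zero; suc; _+_; _*_; _∸_; _/_; _%_; _≤_; _<_; s≤s)
open import Data.Nat.Divisibility using (m∣m*n)
open import Data.Nat.DivMod
  using (m≡m%n+[m/n]*n; m%n<n; m*n/n≡m; /-congˡ; +-distrib-/-∣ˡ; %-remove-+ˡ; m<n⇒m/n≡0; m<n⇒m%n≡m)
open import Data.Nat.Induction using (<-rec)
open import Data.Nat.Properties
  using ( ≤-refl; ≤-trans; ≤-pred; n≤1+n; m≤m+n; m≤n+m; m+n∸m≡n; m+[n∸m]≡n; m∸n≤m
        ; +-comm; *-comm; +-identityʳ)
open import Data.Nat.Tactic.RingSolver using (solve-∀)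
open import Data.Product using (∃-syntax; ∃₂; _×_; _,_; proj₁; proj₂)
open import Data.Sum using (_⊎_; inj₁; inj₂)
open import Function using (case_of_; Equivalence)
open import Induction.WellFounded using (WellFounded; Acc; acc)
open import Relation.Binary.PropositionalEquality
  using (_≡_; _≢_; refl; sym; trans; cong; cong₂; subst)

options : Player → Game → List Game
options 𝓛 ⟨ L ∣ _ ⟩ = L
options 𝓡 ⟨ _ ∣ R ⟩ = R

rightOptions : Game → List Game
rightOptions = options 𝓡

addˡ≡map : ∀ gs H → addˡ gs H ≡ map (_⊕ H) gs
addˡ≡map []       H = refl
addˡ≡map (g ∷ gs) H = cong (g ⊕ H ∷_) (addˡ≡map gs H)

addʳ≡map : ∀ G hs → addʳ G hs ≡ map (G ⊕_) hs
addʳ≡map G []       = refl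
addʳ≡map G (h ∷ hs) = cong (G ⊕ h ∷_) (addʳ≡map G hs)

options-⊕ : ∀ p G H → options p (G ⊕ H) ≡ map (_⊕ H) (options p G) ++ map (G ⊕_) (options p H)
options-⊕ 𝓛 G@(⟨ GL ∣ _ ⟩) H@(⟨ HL ∣ _ ⟩) = cong₂ _++_ (addˡ≡map GL H) (addʳ≡map G HL)
options-⊕ 𝓡 G@(⟨ _ ∣ GR ⟩) H@(⟨ _ ∣ HR ⟩) = cong₂ _++_ (addˡ≡map GR H) (addʳ≡map G HR)

∈-options-⊕⁻ : ∀ p G H {y} → y ∈ options p (G ⊕ H) →
  (∃[ g ] g ∈ options p G × y ≡ g ⊕ H) ⊎ (∃[ h ] h ∈ options p H × y ≡ G ⊕ h)
∈-options-⊕⁻ p G H y∈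
  with ∈-++⁻ (map (_⊕ H) (options p G)) (subst (_ ∈_) (options-⊕ p G H) y∈)
... | inj₁ y∈ˡ = inj₁ (∈-map⁻ (_⊕ H) y∈ˡ)
... | inj₂ y∈ʳ = inj₂ (∈-map⁻ (G ⊕_) y∈ʳ)

∈-options-⊕ˡ : ∀ p G H {g} → g ∈ options p G → g ⊕ H ∈ options p (G ⊕ H)
∈-options-⊕ˡ p G H g∈ =
  subst (_ ∈_) (sym (options-⊕ p G H)) (∈-++⁺ˡ (∈-map⁺ (_⊕ H) g∈))

∈-options-⊕ʳ : ∀ p G H {h} → h ∈ options p H → G ⊕ h ∈ options p (G ⊕ H)
∈-options-⊕ʳ p G H h∈ =
  subst (_ ∈_) (sym (options-⊕ p G H)) (∈-++⁺ʳ _ (∈-map⁺ (G ⊕_) h∈))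

⊕-noRightOptions⁻ : ∀ G H → rightOptions (G ⊕ H) ≡ [] → rightOptions G ≡ [] × rightOptions H ≡ []
⊕-noRightOptions⁻ ⟨ _ ∣ [] ⟩    ⟨ _ ∣ [] ⟩    _ = refl , refl
⊕-noRightOptions⁻ ⟨ _ ∣ _ ∷ _ ⟩ ⟨ _ ∣ _ ⟩     ()
⊕-noRightOptions⁻ ⟨ _ ∣ [] ⟩    ⟨ _ ∣ _ ∷ _ ⟩ ()

⊕-noRightOptions⁺ : ∀ G H → rightOptions G ≡ [] → rightOptions H ≡ [] → rightOptions (G ⊕ H) ≡ []
⊕-noRightOptions⁺ ⟨ _ ∣ [] ⟩ ⟨ _ ∣ [] ⟩ refl refl = refl

someRis𝓛≡𝓡⁻ : ∀ gs → someRis𝓛 gs ≡ 𝓡 → ∀ {g} → g ∈ gs → oᴿ g ≡ 𝓡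
someRis𝓛≡𝓡⁻ (g ∷ gs) e g∈ with oᴿ g in oᴿg
someRis𝓛≡𝓡⁻ (g ∷ gs) () g∈         | 𝓛
someRis𝓛≡𝓡⁻ (g ∷ gs) e  (here refl) | 𝓡 = oᴿg
someRis𝓛≡𝓡⁻ (g ∷ gs) e  (there g∈)  | 𝓡 = someRis𝓛≡𝓡⁻ gs e g∈

someRis𝓛≡𝓡⁺ : ∀ gs → (∀ {g} → g ∈ gs → oᴿ g ≡ 𝓡) → someRis𝓛 gs ≡ 𝓡
someRis𝓛≡𝓡⁺ []       _   = refl
someRis𝓛≡𝓡⁺ (g ∷ gs) all rewrite all (here refl) = someRis𝓛≡𝓡⁺ gs (λ g∈ → all (there g∈))

someLis𝓡≡𝓡⁻ : ∀ gs → someLis𝓡 gs ≡ 𝓡 → ∃[ g ] g ∈ gs × oᴸ g ≡ 𝓡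
someLis𝓡≡𝓡⁻ (g ∷ gs) e with oᴸ g in oᴸg
... | 𝓡 = g , here refl , oᴸg
... | 𝓛 = let g′ , g′∈ , w = someLis𝓡≡𝓡⁻ gs e in g′ , there g′∈ , w

someLis𝓡≡𝓡⁺ : ∀ gs {g} → g ∈ gs → oᴸ g ≡ 𝓡 → someLis𝓡 gs ≡ 𝓡
someLis𝓡≡𝓡⁺ (g ∷ gs) (here refl) w rewrite w = refl
someLis𝓡≡𝓡⁺ (g ∷ gs) (there g∈) w with oᴸ g
... | 𝓡 = refl
... | 𝓛 = someLis𝓡≡𝓡⁺ gs g∈ w

oᴿ≡𝓡⁻ : ∀ G → oᴿ G ≡ 𝓡 → rightOptions G ≡ [] ⊎ ∃[ g ] g ∈ rightOptions G × oᴸ g ≡ 𝓡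
oᴿ≡𝓡⁻ ⟨ _ ∣ [] ⟩     _ = inj₁ refl
oᴿ≡𝓡⁻ ⟨ _ ∣ g ∷ gs ⟩ e = inj₂ (someLis𝓡≡𝓡⁻ (g ∷ gs) e)

oᴿ≡𝓡⁺ : ∀ G → rightOptions G ≡ [] ⊎ ∃[ g ] g ∈ rightOptions G × oᴸ g ≡ 𝓡 → oᴿ G ≡ 𝓡
oᴿ≡𝓡⁺ ⟨ _ ∣ [] ⟩     _                        = refl
oᴿ≡𝓡⁺ ⟨ _ ∣ g ∷ gs ⟩ (inj₂ (_ , g′∈ , w)) = someLis𝓡≡𝓡⁺ (g ∷ gs) g′∈ w

oᴸ-⊕⁻ : ∀ GR X → oᴸ (⟨ [] ∣ GR ⟩ ⊕ X) ≡ 𝓡 →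
  options 𝓛 X ≢ [] × (∀ {x} → x ∈ options 𝓛 X → oᴿ (⟨ [] ∣ GR ⟩ ⊕ x) ≡ 𝓡)
oᴸ-⊕⁻ GR ⟨ []     ∣ _  ⟩ ()
oᴸ-⊕⁻ GR X@(⟨ _ ∷ _ ∣ _ ⟩) e = (λ ()) , λ x∈ → someRis𝓛≡𝓡⁻ _ e (∈-options-⊕ʳ 𝓛 ⟨ [] ∣ GR ⟩ X x∈)

oᴸ-⊕⁺ : ∀ GR X → options 𝓛 X ≢ [] → (∀ {x} → x ∈ options 𝓛 X → oᴿ (⟨ [] ∣ GR ⟩ ⊕ x) ≡ 𝓡) →
  oᴸ (⟨ [] ∣ GR ⟩ ⊕ X) ≡ 𝓡
oᴸ-⊕⁺ GR ⟨ []    ∣ _ ⟩ XL≢[] _   = ⊥-elim (XL≢[] refl)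
oᴸ-⊕⁺ GR X@(⟨ _ ∷ _ ∣ _ ⟩) _   all = someRis𝓛≡𝓡⁺ _ λ y∈ →
  case ∈-options-⊕⁻ 𝓛 ⟨ [] ∣ GR ⟩ X y∈ of λ where
    (inj₁ (_ , () , _))
    (inj₂ (_ , x∈ , refl)) → all x∈

RightFirstWins : Game → Game → Set
RightFirstWins G X =
  (rightOptions G ≡ [] × rightOptions X ≡ [])
  ⊎ (∃[ g ] g ∈ rightOptions G × oᴸ (g ⊕ X) ≡ 𝓡)
  ⊎ (∃[ x ] x ∈ rightOptions X × oᴸ (G ⊕ x) ≡ 𝓡)

oᴿ-⊕⁻ : ∀ G X → oᴿ (G ⊕ X) ≡ 𝓡 → RightFirstWins G X
oᴿ-⊕⁻ G X e with oᴿ≡𝓡⁻ (G ⊕ X) e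
... | inj₁ none = inj₁ (⊕-noRightOptions⁻ G X none)
... | inj₂ (y , y∈ , w) with ∈-options-⊕⁻ 𝓡 G X y∈
...   | inj₁ (g , g∈ , refl) = inj₂ (inj₁ (g , g∈ , w))
...   | inj₂ (x , x∈ , refl) = inj₂ (inj₂ (x , x∈ , w))

oᴿ-⊕⁺ : ∀ G X → RightFirstWins G X → oᴿ (G ⊕ X) ≡ 𝓡
oᴿ-⊕⁺ G X (inj₁ (G∅ , X∅))          = oᴿ≡𝓡⁺ (G ⊕ X) (inj₁ (⊕-noRightOptions⁺ G X G∅ X∅))
oᴿ-⊕⁺ G X (inj₂ (inj₁ (g , g∈ , w))) = oᴿ≡𝓡⁺ (G ⊕ X) (inj₂ (g ⊕ X , ∈-options-⊕ˡ 𝓡 G X g∈ , w))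
oᴿ-⊕⁺ G X (inj₂ (inj₂ (x , x∈ , w))) = oᴿ≡𝓡⁺ (G ⊕ X) (inj₂ (G ⊕ x , ∈-options-⊕ʳ 𝓡 G X x∈ , w))

_◃_ : Game → Game → Set
x ◃ G = ∃[ p ] x ∈ options p G

◃-wellFounded : WellFounded _◃_
◃-wellFounded ⟨ L ∣ R ⟩ = acc λ where
    (𝓛 , x∈) → members L x∈
    (𝓡 , x∈) → members R x∈
  where
  members : ∀ xs {x} → x ∈ xs → Acc _◃_ x
  members (y ∷ _)  (here refl) = ◃-wellFounded y
  members (_ ∷ ys) (there x∈)  = members ys x∈

data LeftFree : Game → Set where
  leftFree : ∀ {R} → (∀ {g} → g ∈ R → LeftFree g) → LeftFree ⟨ [] ∣ R ⟩

infix 4 _≼_ _≈_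

mutual
  data _≼_ : Game → Game → Set where
    dom : ∀ {GR HR} → (HR ≡ [] → GR ≡ []) → (∀ {h} → h ∈ HR → Answers ⟨ [] ∣ GR ⟩ h) →
          ⟨ [] ∣ GR ⟩ ≼ ⟨ [] ∣ HR ⟩

  Answers : Game → Game → Set
  Answers G h = ∃[ g ] g ∈ rightOptions G × g ≼ h

_≈_ : Game → Game → Set
G ≈ H = G ≼ H × H ≼ G

mutual
  ≼-oᴸ : ∀ {G H X} → G ≼ H → Acc _◃_ X → oᴸ (H ⊕ X) ≡ 𝓡 → oᴸ (G ⊕ X) ≡ 𝓡
  ≼-oᴸ {⟨ [] ∣ GR ⟩} {⟨ [] ∣ HR ⟩} {X} G≼H (acc rs) hyp =
    let XL≢[] , losing = oᴸ-⊕⁻ HR X hyp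
    in oᴸ-⊕⁺ GR X XL≢[] λ x∈ → ≼-oᴿ G≼H (rs (𝓛 , x∈)) (losing x∈)

  ≼-oᴿ : ∀ {G H X} → G ≼ H → Acc _◃_ X → oᴿ (H ⊕ X) ≡ 𝓡 → oᴿ (G ⊕ X) ≡ 𝓡
  ≼-oᴿ {G} {H} {X} G≼H ac hyp = oᴿ-⊕⁺ G X (≼-RightFirstWins G≼H ac (oᴿ-⊕⁻ H X hyp))

  ≼-RightFirstWins : ∀ {G H X} → G ≼ H → Acc _◃_ X → RightFirstWins H X → RightFirstWins G X
  ≼-RightFirstWins (dom end _) _ (inj₁ (H∅ , X∅)) = inj₁ (end H∅ , X∅)
  ≼-RightFirstWins (dom _ answer) ac (inj₂ (inj₁ (h , h∈ , w))) =
    let g , g∈ , g≼h = answer h∈ in inj₂ (inj₁ (g , g∈ , ≼-oᴸ g≼h ac w))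
  ≼-RightFirstWins G≼H (acc rs) (inj₂ (inj₂ (x , x∈ , w))) =
    inj₂ (inj₂ (x , x∈ , ≼-oᴸ G≼H (rs (𝓡 , x∈)) w))

player-≡ : ∀ {a b} → (a ≡ 𝓡 → b ≡ 𝓡) → (b ≡ 𝓡 → a ≡ 𝓡) → a ≡ b
player-≡ {𝓛} {𝓛} _ _ = refl
player-≡ {𝓛} {𝓡} _ b⇒a = case b⇒a refl of λ ()
player-≡ {𝓡} {𝓛} a⇒b _ = case a⇒b refl of λ ()
player-≡ {𝓡} {𝓡} _ _ = refl

≈⇒≡ₘ : ∀ {G H} → G ≈ H → G ≡ₘ H
≈⇒≡ₘ (G≼H , H≼G) X = cong₂ outcomeOf
  (player-≡ (≼-oᴸ H≼G (◃-wellFounded X)) (≼-oᴸ G≼H (◃-wellFounded X)))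
  (player-≡ (≼-oᴿ H≼G (◃-wellFounded X)) (≼-oᴿ G≼H (◃-wellFounded X)))

⊕-rightOption-cases : ∀ {ℓ} (P : Game → Set ℓ) G H →
  (∀ {g} → g ∈ rightOptions G → P (g ⊕ H)) → (∀ {h} → h ∈ rightOptions H → P (G ⊕ h)) →
  ∀ {y} → y ∈ rightOptions (G ⊕ H) → P y
⊕-rightOption-cases P G H left right y∈ with ∈-options-⊕⁻ 𝓡 G H y∈
... | inj₁ (_ , g∈ , refl) = left g∈
... | inj₂ (_ , h∈ , refl) = right h∈

LeftFree-⊕ : ∀ {G H} → LeftFree G → LeftFree H → LeftFree (G ⊕ H)
LeftFree-⊕ {G} {H} lfG@(leftFree fG) lfH@(leftFree fH) = leftFree
  (⊕-rightOption-cases LeftFree G H (λ g∈ → LeftFree-⊕ (fG g∈) lfH) (λ h∈ → LeftFree-⊕ lfG (fH h∈)))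

≼-answers : ∀ {G H h} → G ≼ H → h ∈ rightOptions H → Answers G h
≼-answers (dom _ answer) = answer

≼-intro : ∀ {G H} → LeftFree G → LeftFree H →
  (rightOptions H ≡ [] → rightOptions G ≡ []) → (∀ {h} → h ∈ rightOptions H → Answers G h) → G ≼ H
≼-intro (leftFree _) (leftFree _) = dom

≼-refl : ∀ {G} → LeftFree G → G ≼ G
≼-refl (leftFree f) = dom (λ G∅ → G∅) λ {g} g∈ → g , g∈ , ≼-refl (f g∈)

≼-trans : ∀ {G H K} → G ≼ H → H ≼ K → G ≼ K
≼-trans (dom end₁ answer₁) (dom end₂ answer₂) = dom (λ K∅ → end₁ (end₂ K∅)) λ k∈ →
  let h , h∈ , h≼k = answer₂ k∈
      g , g∈ , g≼h = answer₁ h∈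
  in g , g∈ , ≼-trans g≼h h≼k

⊕-mono-≼ : ∀ {G H G′ H′} → G ≼ H → G′ ≼ H′ → G ⊕ G′ ≼ H ⊕ H′
⊕-mono-≼ {G} {H} {G′} {H′} G≼H@(dom end answer) G′≼H′@(dom end′ answer′) = dom
  (λ none → let H∅ , H′∅ = ⊕-noRightOptions⁻ H H′ none in ⊕-noRightOptions⁺ G G′ (end H∅) (end′ H′∅))
  (⊕-rightOption-cases (Answers (G ⊕ G′)) H H′
    (λ h∈ → let g , g∈ , g≼h = answer h∈ in
      g ⊕ G′ , ∈-options-⊕ˡ 𝓡 G G′ g∈ , ⊕-mono-≼ g≼h G′≼H′)
    (λ h′∈ → let g′ , g′∈ , g′≼h′ = answer′ h′∈ in
      G ⊕ g′ , ∈-options-⊕ʳ 𝓡 G G′ g′∈ , ⊕-mono-≼ G≼H g′≼h′))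

≼-Answers : ∀ {G G′ h} → G′ ≼ G → Answers G h → Answers G′ h
≼-Answers G′≼G (g , g∈ , g≼h) = let g′ , g′∈ , g′≼g = ≼-answers G′≼G g∈ in g′ , g′∈ , ≼-trans g′≼g g≼h

Answers-≼ : ∀ {G h h′} → Answers G h → h ≼ h′ → Answers G h′
Answers-≼ (g , g∈ , g≼h) h≼h′ = g , g∈ , ≼-trans g≼h h≼h′

Answers-⊕ˡ : ∀ {X G h} → LeftFree X → Answers G h → Answers (X ⊕ G) (X ⊕ h)
Answers-⊕ˡ {X} {G} lfX (g , g∈ , g≼h) = X ⊕ g , ∈-options-⊕ʳ 𝓡 X G g∈ , ⊕-mono-≼ (≼-refl lfX) g≼h

≼-comm : ∀ {G H} → LeftFree G → LeftFree H → G ⊕ H ≼ H ⊕ G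
≼-comm {G} {H} lfG@(leftFree fG) lfH@(leftFree fH) = dom
  (λ none → let H∅ , G∅ = ⊕-noRightOptions⁻ H G none in ⊕-noRightOptions⁺ G H G∅ H∅)
  (⊕-rightOption-cases (Answers (G ⊕ H)) H G
    (λ {h} h∈ → G ⊕ h , ∈-options-⊕ʳ 𝓡 G H h∈ , ≼-comm lfG (fH h∈))
    (λ {g} g∈ → g ⊕ H , ∈-options-⊕ˡ 𝓡 G H g∈ , ≼-comm (fG g∈) lfH))

≼-assoc : ∀ {G H K} → LeftFree G → LeftFree H → LeftFree K → (G ⊕ H) ⊕ K ≼ G ⊕ (H ⊕ K)
≼-assoc {G} {H} {K} lfG@(leftFree fG) lfH@(leftFree fH) lfK@(leftFree fK) = dom
  (λ none → let G∅ , HK∅ = ⊕-noRightOptions⁻ G (H ⊕ K) none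
                H∅ , K∅ = ⊕-noRightOptions⁻ H K HK∅
            in ⊕-noRightOptions⁺ (G ⊕ H) K (⊕-noRightOptions⁺ G H G∅ H∅) K∅)
  (⊕-rightOption-cases (Answers ((G ⊕ H) ⊕ K)) G (H ⊕ K)
    (λ {g} g∈ → (g ⊕ H) ⊕ K , ∈-options-⊕ˡ 𝓡 (G ⊕ H) K (∈-options-⊕ˡ 𝓡 G H g∈) ,
                ≼-assoc (fG g∈) lfH lfK)
    (⊕-rightOption-cases (λ y → Answers ((G ⊕ H) ⊕ K) (G ⊕ y)) H K
      (λ {h} h∈ → (G ⊕ h) ⊕ K , ∈-options-⊕ˡ 𝓡 (G ⊕ H) K (∈-options-⊕ʳ 𝓡 G H h∈) ,
                  ≼-assoc lfG (fH h∈) lfK)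
      (λ {k} k∈ → (G ⊕ H) ⊕ k , ∈-options-⊕ʳ 𝓡 (G ⊕ H) K k∈ , ≼-assoc lfG lfH (fK k∈))))

⊕-identityʳ : ∀ {G} → LeftFree G → G ⊕ 0G ≈ G
⊕-identityʳ {G} (leftFree f) =
  dom (λ G∅ → ⊕-noRightOptions⁺ G 0G G∅ refl)
      (λ {g} g∈ → g ⊕ 0G , ∈-options-⊕ˡ 𝓡 G 0G g∈ , proj₁ (⊕-identityʳ (f g∈))) ,
  dom (λ none → proj₁ (⊕-noRightOptions⁻ G 0G none))
      (⊕-rightOption-cases (Answers G) G 0G
        (λ {g} g∈ → g , g∈ , proj₂ (⊕-identityʳ (f g∈)))
        (λ ()))

≈-refl : ∀ {G} → LeftFree G → G ≈ G
≈-refl lf = ≼-refl lf , ≼-refl lf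

≈-sym : ∀ {G H} → G ≈ H → H ≈ G
≈-sym (G≼H , H≼G) = H≼G , G≼H

≈-trans : ∀ {G H K} → G ≈ H → H ≈ K → G ≈ K
≈-trans (G≼H , H≼G) (H≼K , K≼H) = ≼-trans G≼H H≼K , ≼-trans K≼H H≼G

⊕-cong : ∀ {G H G′ H′} → G ≈ H → G′ ≈ H′ → G ⊕ G′ ≈ H ⊕ H′
⊕-cong (G≼H , H≼G) (G′≼H′ , H′≼G′) = ⊕-mono-≼ G≼H G′≼H′ , ⊕-mono-≼ H≼G H′≼G′

⊕-comm : ∀ {G H} → LeftFree G → LeftFree H → G ⊕ H ≈ H ⊕ G
⊕-comm lfG lfH = ≼-comm lfG lfH , ≼-comm lfH lfG

-- The converse of ≼-assoc comes from rotating the three summands with ≼-comm.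
⊕-assoc : ∀ {G H K} → LeftFree G → LeftFree H → LeftFree K → (G ⊕ H) ⊕ K ≈ G ⊕ (H ⊕ K)
⊕-assoc lfG lfH lfK = ≼-assoc lfG lfH lfK ,
  ≼-trans (≼-comm lfG (LeftFree-⊕ lfH lfK)) (≼-trans (≼-assoc lfH lfK lfG)
  (≼-trans (≼-comm lfH (LeftFree-⊕ lfK lfG)) (≼-trans (≼-assoc lfK lfG lfH)
  (≼-comm lfK (LeftFree-⊕ lfG lfH)))))

⊕-leftComm : ∀ {G H K} → LeftFree G → LeftFree H → LeftFree K → G ⊕ (H ⊕ K) ≈ H ⊕ (G ⊕ K)
⊕-leftComm lfG lfH lfK = ≈-trans (≈-sym (⊕-assoc lfG lfH lfK))
  (≈-trans (⊕-cong (⊕-comm lfG lfH) (≈-refl lfK)) (⊕-assoc lfH lfG lfK))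

⊕-interchange : ∀ {G H K L} → LeftFree G → LeftFree H → LeftFree K → LeftFree L →
  (G ⊕ H) ⊕ (K ⊕ L) ≈ (G ⊕ K) ⊕ (H ⊕ L)
⊕-interchange lfG lfH lfK lfL = ≈-trans (⊕-assoc lfG lfH (LeftFree-⊕ lfK lfL))
  (≈-trans (⊕-cong (≈-refl lfG) (⊕-leftComm lfH lfK lfL)) (≈-sym (⊕-assoc lfG lfK (LeftFree-⊕ lfH lfL))))

LeftFree-0 : LeftFree 0G
LeftFree-0 = leftFree λ ()

LeftFree-bar1 : LeftFree bar1
LeftFree-bar1 = leftFree λ { (here refl) → LeftFree-0 ; (there ()) }

LeftFree-bar2 : LeftFree bar2
LeftFree-bar2 = leftFree λ { (here refl) → LeftFree-bar1 ; (there ()) }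

LeftFree-bar10 : LeftFree bar10
LeftFree-bar10 = leftFree λ where
  (here refl)         → LeftFree-bar1
  (there (here refl)) → LeftFree-0
  (there (there ()))

LeftFree-bar10# : LeftFree bar10#
LeftFree-bar10# = leftFree λ { (here refl) → LeftFree-bar10 ; (there ()) }

LeftFree-· : ∀ {G} → LeftFree G → ∀ k → LeftFree (k · G)
LeftFree-· lfG zero    = LeftFree-0
LeftFree-· lfG (suc k) = LeftFree-⊕ lfG (LeftFree-· lfG k)

LeftFree-·bar10# : ∀ k → LeftFree (k · bar10#)
LeftFree-·bar10# = LeftFree-· LeftFree-bar10#

·-distribʳ-+ : ∀ {G} → LeftFree G → ∀ j k → (j + k) · G ≈ j · G ⊕ k · G
·-distribʳ-+ lfG zero k = ≈-sym (≈-trans (⊕-comm LeftFree-0 lfk) (⊕-identityʳ lfk))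
  where lfk = LeftFree-· lfG k
·-distribʳ-+ lfG (suc j) k = ≈-trans (⊕-cong (≈-refl lfG) (·-distribʳ-+ lfG j k))
  (≈-sym (⊕-assoc lfG (LeftFree-· lfG j) (LeftFree-· lfG k)))

·-rightOption : ∀ {G} → LeftFree G → ∀ K {x} → x ∈ rightOptions (suc K · G) →
  ∃[ g ] g ∈ rightOptions G × K · G ⊕ g ≼ x
·-rightOption {G} lfG@(leftFree f) K = ⊕-rightOption-cases _ G (K · G)
  (λ g∈ → _ , g∈ , ≼-comm (LeftFree-· lfG K) (f g∈))
  (fromMultiple K)
  where
  fromMultiple : ∀ K {y} → y ∈ rightOptions (K · G) → ∃[ g ] g ∈ rightOptions G × K · G ⊕ g ≼ G ⊕ y
  fromMultiple zero    ()
  fromMultiple (suc K′) y∈ = let g , g∈ , K′G⊕g≼y = ·-rightOption lfG K′ y∈ in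
    g , g∈ , ≼-trans (≼-assoc lfG (LeftFree-· lfG K′) (f g∈)) (⊕-mono-≼ (≼-refl lfG) K′G⊕g≼y)

LeftFree-V : ∀ k r → LeftFree (V k r)
LeftFree-V k 0 = LeftFree-·bar10# k
LeftFree-V k 1 = LeftFree-·bar10# k
LeftFree-V k 2 = LeftFree-⊕ (LeftFree-·bar10# k) LeftFree-bar1
LeftFree-V k 3 = LeftFree-⊕ (LeftFree-·bar10# k) LeftFree-bar1
LeftFree-V k 4 = LeftFree-⊕ (LeftFree-·bar10# k) LeftFree-bar10
LeftFree-V k 5 = LeftFree-⊕ (LeftFree-·bar10# k) LeftFree-bar2
LeftFree-V k (suc (suc (suc (suc (suc (suc _)))))) = LeftFree-0

·-distribʳ-+-⊕ : ∀ {G P} → LeftFree G → LeftFree P → ∀ j k → (j + k) · G ⊕ P ≈ j · G ⊕ (k · G ⊕ P)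
·-distribʳ-+-⊕ lfG lfP j k = ≈-trans (⊕-cong (·-distribʳ-+ lfG j k) (≈-refl lfP))
  (⊕-assoc (LeftFree-· lfG j) (LeftFree-· lfG k) lfP)

V-shift : ∀ j k r → r < 6 → V (j + k) r ≈ j · bar10# ⊕ V k r
V-shift j k 0 _ = ·-distribʳ-+ LeftFree-bar10# j k
V-shift j k 1 _ = ·-distribʳ-+ LeftFree-bar10# j k
V-shift j k 2 _ = ·-distribʳ-+-⊕ LeftFree-bar10# LeftFree-bar1 j k
V-shift j k 3 _ = ·-distribʳ-+-⊕ LeftFree-bar10# LeftFree-bar1 j k
V-shift j k 4 _ = ·-distribʳ-+-⊕ LeftFree-bar10# LeftFree-bar10 j k
V-shift j k 5 _ = ·-distribʳ-+-⊕ LeftFree-bar10# LeftFree-bar2 j k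
V-shift j k (suc (suc (suc (suc (suc (suc _)))))) (s≤s (s≤s (s≤s (s≤s (s≤s (s≤s ()))))))

value : ℕ → Game
value n = V (n / 6) (n % 6)

LeftFree-value : ∀ n → LeftFree (value n)
LeftFree-value n = LeftFree-V (n / 6) (n % 6)

[6k+n]/6≡k+n/6 : ∀ k n → (6 * k + n) / 6 ≡ k + n / 6
[6k+n]/6≡k+n/6 k n = trans (+-distrib-/-∣ˡ n (m∣m*n k))
  (cong (_+ n / 6) (trans (/-congˡ (*-comm 6 k)) (m*n/n≡m k 6)))

[6k+n]%6≡n%6 : ∀ k n → (6 * k + n) % 6 ≡ n % 6
[6k+n]%6≡n%6 k n = %-remove-+ˡ n (m∣m*n k)

divMod6 : ∀ n → ∃₂ λ k r → r < 6 × n ≡ 6 * k + r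
divMod6 n = n / 6 , n % 6 , m%n<n n 6 ,
  trans (m≡m%n+[m/n]*n n 6) (trans (+-comm (n % 6) _) (cong (_+ n % 6) (*-comm (n / 6) 6)))

value-shift : ∀ K N → value (6 * K + N) ≈ K · bar10# ⊕ value N
value-shift K N rewrite [6k+n]/6≡k+n/6 K N | [6k+n]%6≡n%6 K N = V-shift K (N / 6) (N % 6) (m%n<n N 6)

value-6k+r : ∀ k r → r < 6 → value (6 * k + r) ≡ V k r
value-6k+r k r r<6
  rewrite [6k+n]/6≡k+n/6 k r | [6k+n]%6≡n%6 k r | m<n⇒m/n≡0 r<6 | m<n⇒m%n≡m r<6 | +-identityʳ k = refl

infix 4 _≼?_

mutual
  _≼?_ : Game → Game → Bool
  ⟨ [] ∣ GR ⟩    ≼? ⟨ [] ∣ [] ⟩     = null GR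
  ⟨ [] ∣ GR ⟩    ≼? ⟨ [] ∣ h ∷ hs ⟩ = answersAll? GR (h ∷ hs)
  ⟨ [] ∣ _ ⟩     ≼? ⟨ _ ∷ _ ∣ _ ⟩   = false
  ⟨ _ ∷ _ ∣ _ ⟩ ≼? _               = false

  answersAll? : List Game → List Game → Bool
  answersAll? gs []       = true
  answersAll? gs (h ∷ hs) = answers? gs h ∧ answersAll? gs hs

  answers? : List Game → Game → Bool
  answers? []       h = false
  answers? (g ∷ gs) h = (g ≼? h) ∨ answers? gs h

mutual
  ≼?-sound : ∀ G H → T (G ≼? H) → G ≼ H
  ≼?-sound ⟨ [] ∣ [] ⟩ ⟨ [] ∣ [] ⟩     _ = dom (λ _ → refl) (λ ())
  ≼?-sound ⟨ [] ∣ GR ⟩ ⟨ [] ∣ h ∷ hs ⟩ t = dom (λ ()) (answersAll?-sound GR (h ∷ hs) t)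

  answersAll?-sound : ∀ gs hs → T (answersAll? gs hs) → ∀ {h} → h ∈ hs → ∃[ g ] g ∈ gs × g ≼ h
  answersAll?-sound gs (h ∷ hs) t (here refl) = answers?-sound gs h (proj₁ (Equivalence.to T-∧ t))
  answersAll?-sound gs (h ∷ hs) t (there h∈)  = answersAll?-sound gs hs (proj₂ (Equivalence.to T-∧ t)) h∈

  answers?-sound : ∀ gs h → T (answers? gs h) → ∃[ g ] g ∈ gs × g ≼ h
  answers?-sound (g ∷ gs) h t with Equivalence.to (T-∨ {g ≼? h}) t
  ... | inj₁ g≼?h = g , here refl , ≼?-sound g h g≼?h
  ... | inj₂ rest  = let g′ , g′∈ , g′≼h = answers?-sound gs h rest in g′ , there g′∈ , g′≼h

T-all-upTo : ∀ (p : ℕ → Bool) n → T (all p (upTo n)) → ∀ {i} → i < n → T (p i)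
T-all-upTo p n t i<n = All.lookup (all⁺ p (upTo n) t) (∈-upTo⁺ i<n)

-- The pairs (a , b) with 2 + a + b ≡ n are the moves of D n (see ∈-rightOptions-D).
SplitAnswers : ℕ → Game → Set
SplitAnswers n h = ∃₂ λ a b → 2 + a + b ≡ n × value a ⊕ value b ≼ h

SplitAnswers-≼ : ∀ {n h h′} → SplitAnswers n h → h ≼ h′ → SplitAnswers n h′
SplitAnswers-≼ (a , b , eq , s) h≼h′ = a , b , eq , ≼-trans s h≼h′

SplitAnswers-shift : ∀ K {N h} → SplitAnswers N h → SplitAnswers (6 * K + N) (K · bar10# ⊕ h)
SplitAnswers-shift K (a , b , refl , s) = a , 6 * K + b , arith K a b ,
  ≼-trans (⊕-mono-≼ (≼-refl lfa) (proj₁ (value-shift K b)))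
  (≼-trans (proj₁ (⊕-leftComm lfa (LeftFree-·bar10# K) (LeftFree-value b)))
  (⊕-mono-≼ (≼-refl (LeftFree-·bar10# K)) s))
  where
  lfa = LeftFree-value a
  arith : ∀ K a b → 2 + a + (6 * K + b) ≡ 6 * K + (2 + a + b)
  arith = solve-∀

splitAnswers? : ℕ → Game → Bool
splitAnswers? (suc (suc m)) h = any (λ a → value a ⊕ value (m ∸ a) ≼? h) (upTo (suc m))
splitAnswers? _             _ = false

splitAnswers?-sound : ∀ n h → T (splitAnswers? n h) → SplitAnswers n h
splitAnswers?-sound (suc (suc m)) h t with find (any⁻ _ (upTo (suc m)) t)
... | a , a∈ , a-answers =
  a , m ∸ a , cong (2 +_) (m+[n∸m]≡n (≤-pred (∈-upTo⁻ a∈))) , ≼?-sound _ h a-answers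

-- The three finite facts below are decided by evaluation: each `_` is a proof of T true.
answers-split-small : ∀ {a b} → a < 6 → b < 6 → Answers (value (2 + a + b)) (value a ⊕ value b)
answers-split-small {a} {b} a<6 b<6 =
  answers?-sound _ _ (T-all-upTo (check a) 6 (T-all-upTo (λ a → all (check a) (upTo 6)) 6 _ a<6) b<6)
  where
  check : ℕ → ℕ → Bool
  check a b = answers? (rightOptions (value (2 + a + b))) (value a ⊕ value b)

splitAnswers-option-small : ∀ {r h} → r < 6 → h ∈ rightOptions (value r) → SplitAnswers r h
splitAnswers-option-small {r} r<6 h∈ = splitAnswers?-sound r _
  (All.lookup (all⁺ (splitAnswers? r) _ (T-all-upTo check 6 _ r<6)) h∈)
  where
  check : ℕ → Bool
  check r = all (splitAnswers? r) (rightOptions (value r))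

splitAnswers-bar10-small : ∀ {r} → r < 6 → SplitAnswers (6 + r) (bar10 ⊕ value r)
splitAnswers-bar10-small {r} r<6 =
  splitAnswers?-sound (6 + r) _ (T-all-upTo (λ r → splitAnswers? (6 + r) (bar10 ⊕ value r)) 6 _ r<6)

answers-split : ∀ a b → Answers (value (2 + a + b)) (value a ⊕ value b)
answers-split a b with divMod6 a | divMod6 b
... | ka , ra , ra<6 , refl | kb , rb , rb<6 , refl =
  Answers-≼ {G = value (2 + (6 * ka + ra) + (6 * kb + rb))} (≼-Answers (proj₁ target)
    (Answers-⊕ˡ (LeftFree-·bar10# (ka + kb)) (answers-split-small ra<6 rb<6))) (proj₂ source)
  where
  arith : ∀ ka ra kb rb → 2 + (6 * ka + ra) + (6 * kb + rb) ≡ 6 * (ka + kb) + (2 + ra + rb)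
  arith = solve-∀
  target : value (2 + (6 * ka + ra) + (6 * kb + rb)) ≈ (ka + kb) · bar10# ⊕ value (2 + ra + rb)
  target = subst (λ n → value n ≈ (ka + kb) · bar10# ⊕ value (2 + ra + rb)) (sym (arith ka ra kb rb))
    (value-shift (ka + kb) (2 + ra + rb))
  source : value (6 * ka + ra) ⊕ value (6 * kb + rb) ≈ (ka + kb) · bar10# ⊕ (value ra ⊕ value rb)
  source = ≈-trans (⊕-cong (value-shift ka ra) (value-shift kb rb))
    (≈-trans (⊕-interchange (LeftFree-·bar10# ka) (LeftFree-value ra)
                            (LeftFree-·bar10# kb) (LeftFree-value rb))
    (⊕-cong (≈-sym (·-distribʳ-+ LeftFree-bar10# ka kb))
            (≈-refl (LeftFree-⊕ (LeftFree-value ra) (LeftFree-value rb)))))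

splitAnswers-option : ∀ n {h} → h ∈ rightOptions (value n) → SplitAnswers n h
splitAnswers-option n h∈ with divMod6 n
... | k , r , r<6 , refl =
  let y , y∈ , y≼h = ≼-answers (proj₂ (value-shift k r)) h∈
  in SplitAnswers-≼ (⊕-rightOption-cases (SplitAnswers (6 * k + r)) (k · bar10#) (value r)
       (multiple-option k) (λ q∈ → SplitAnswers-shift k (splitAnswers-option-small r<6 q∈)) y∈) y≼h
  where
  lfr = LeftFree-value r
  arith : ∀ K r → 6 * K + (6 + r) ≡ 6 * suc K + r
  arith = solve-∀
  multiple-option : ∀ k {x} → x ∈ rightOptions (k · bar10#) → SplitAnswers (6 * k + r) (x ⊕ value r)
  multiple-option zero    ()
  multiple-option (suc K) x∈ with ·-rightOption LeftFree-bar10# K x∈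
  ... | _ , here refl , s =
    SplitAnswers-≼
      (subst (λ n → SplitAnswers n (K · bar10# ⊕ (bar10 ⊕ value r))) (arith K r)
        (SplitAnswers-shift K (splitAnswers-bar10-small r<6)))
      (≼-trans (proj₂ (⊕-assoc (LeftFree-·bar10# K) LeftFree-bar10 lfr)) (⊕-mono-≼ s (≼-refl lfr)))

Dfuel-irrelevant : ∀ f g n → n ≤ f → n ≤ g → Dfuel f n ≡ Dfuel g n
Dfuel-irrelevant zero    zero    zero          _           _           = refl
Dfuel-irrelevant zero    (suc g) zero          _           _           = refl
Dfuel-irrelevant (suc f) zero    zero          _           _           = refl
Dfuel-irrelevant (suc f) (suc g) zero          _           _           = refl
Dfuel-irrelevant (suc f) (suc g) (suc zero)    _           _           = refl
Dfuel-irrelevant (suc f) (suc g) (suc (suc m)) (s≤s m<f) (s≤s m<g) =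
  cong (λ R → ⟨ [] ∣ R ⟩) (map-cong-local (All.tabulate λ {a} a∈ →
    let a≤m = ≤-pred (∈-upTo⁻ a∈) in cong₂ _⊕_ (below a a≤m) (below (m ∸ a) (m∸n≤m m a))))
  where
  below : ∀ c → c ≤ m → Dfuel f c ≡ Dfuel g c
  below c c≤m = Dfuel-irrelevant f g c
    (≤-trans c≤m (≤-trans (n≤1+n m) m<f)) (≤-trans c≤m (≤-trans (n≤1+n m) m<g))

rightOptions-D : ∀ m → rightOptions (D (2 + m)) ≡ map (λ a → D a ⊕ D (m ∸ a)) (upTo (suc m))
rightOptions-D m = map-cong-local (All.tabulate λ {a} a∈ →
  let a≤m = ≤-pred (∈-upTo⁻ a∈) in
  cong₂ _⊕_ (Dfuel-irrelevant (suc m) a a (≤-trans a≤m (n≤1+n m)) ≤-refl)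
            (Dfuel-irrelevant (suc m) (m ∸ a) (m ∸ a) (≤-trans (m∸n≤m m a) (n≤1+n m)) ≤-refl))

∈-rightOptions-D : ∀ a b → D a ⊕ D b ∈ rightOptions (D (2 + a + b))
∈-rightOptions-D a b = subst (λ c → D a ⊕ D c ∈ rightOptions (D (2 + a + b))) (m+n∸m≡n a b)
  (subst (D a ⊕ D (a + b ∸ a) ∈_) (sym (rightOptions-D (a + b)))
    (∈-map⁺ (λ c → D c ⊕ D (a + b ∸ c)) (∈-upTo⁺ (s≤s (m≤m+n a b)))))

∈-rightOptions-D⁻ : ∀ m {y} → y ∈ rightOptions (D (2 + m)) → ∃₂ λ a b → 2 + a + b ≡ 2 + m × y ≡ D a ⊕ D b
∈-rightOptions-D⁻ m {y} y∈ with ∈-map⁻ (λ a → D a ⊕ D (m ∸ a)) (subst (y ∈_) (rightOptions-D m) y∈)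
... | a , a∈ , y≡ = a , m ∸ a , cong (2 +_) (m+[n∸m]≡n (≤-pred (∈-upTo⁻ a∈))) , y≡

LeftFree-Dfuel : ∀ f n → LeftFree (Dfuel f n)
LeftFree-Dfuel zero    _             = LeftFree-0
LeftFree-Dfuel (suc f) zero          = LeftFree-0
LeftFree-Dfuel (suc f) (suc zero)    = LeftFree-0
LeftFree-Dfuel (suc f) (suc (suc m)) = leftFree λ y∈ →
  let a , _ , y≡ = ∈-map⁻ _ y∈ in
  subst LeftFree (sym y≡) (LeftFree-⊕ (LeftFree-Dfuel f a) (LeftFree-Dfuel f (m ∸ a)))

LeftFree-D : ∀ n → LeftFree (D n)
LeftFree-D n = LeftFree-Dfuel n n

sum-≈ : ∀ {n a b} → (∀ {c} → c < n → D c ≈ value c) → 2 + a + b ≡ n → D a ⊕ D b ≈ value a ⊕ value b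
sum-≈ {a = a} {b} ih refl =
  ⊕-cong (ih (s≤s (≤-trans (m≤m+n a b) (n≤1+n _)))) (ih (s≤s (≤-trans (m≤n+m b a) (n≤1+n _))))

D≼value-step : ∀ m → (∀ {c} → c < 2 + m → D c ≈ value c) → D (2 + m) ≼ value (2 + m)
D≼value-step m ih = ≼-intro (LeftFree-D (2 + m)) (LeftFree-value (2 + m)) value-has-option λ h∈ →
  let a , b , eq , s = splitAnswers-option (2 + m) h∈
  in D a ⊕ D b , subst (λ n → D a ⊕ D b ∈ rightOptions (D n)) eq (∈-rightOptions-D a b) ,
     ≼-trans (proj₁ (sum-≈ ih eq)) s
  where
  value-has-option : rightOptions (value (2 + m)) ≡ [] → rightOptions (D (2 + m)) ≡ []
  value-has-option none with answers-split 0 m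
  ... | g , g∈ , _ with subst (g ∈_) none g∈
  ...   | ()

value≼D-step : ∀ m → (∀ {c} → c < 2 + m → D c ≈ value c) → value (2 + m) ≼ D (2 + m)
value≼D-step m ih = ≼-intro (LeftFree-value (2 + m)) (LeftFree-D (2 + m)) (λ ()) answer
  where
  answer : ∀ {y} → y ∈ rightOptions (D (2 + m)) → Answers (value (2 + m)) y
  answer y∈ with ∈-rightOptions-D⁻ m y∈
  ... | a , b , eq , refl =
    Answers-≼ {G = value (2 + m)} (subst (λ n → Answers (value n) (value a ⊕ value b)) eq (answers-split a b))
      (proj₂ (sum-≈ ih eq))

D≈value : ∀ n → D n ≈ value n
D≈value = <-rec (λ n → D n ≈ value n) λ where
  0             _  → ≈-refl LeftFree-0
  1             _  → ≈-refl LeftFree-0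
  (suc (suc m)) ih → D≼value-step m ih , value≼D-step m ih

theorem6p1 : (n k r : ℕ) → n ≡ 6 * k + r → r ≤ 5 → D n ≡ₘ V k r
theorem6p1 n k r refl r≤5 =
  ≈⇒≡ₘ (subst (D (6 * k + r) ≈_) (value-6k+r k r (s≤s r≤5)) (D≈value (6 * k + r)))
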